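{- Suppose $Y\subset X=W_w(n,q)$ is an $(r,s)$-$(n,w,q,\lambda)$-design. Let $s',r'$ be nonnegative integers with $s'\le s$ and $s'\le r'\le r$. For $\omega=(\omega_1,\ldots,\omega_{s'})\in\overline{F}^{s'}$ and subsets $\mathcal{S}'=\{i_1,\ldots,i_{s'}\}\subset\mathcal{R}'\subset N$ with $|\mathcal{S}'|=s'$, $|\mathcal{R}'|=r'$, define \[ Y'=\{(y_i)_{i\in N\setminus\mathcal{R}'}\mid y=(y_i)_{i\in N}\in Y,\ \mathcal{R}'\subset\overline{y},\ y_{i_j}=\omega_j\ (j=1,\ldots,s')\}. \] Then $Y'$ is an $(r-r',s-s')$-$(n-r',w-r',q,\lambda)$-design.
   Context: Let $q\ge 2$, $n\ge1$, $0\le w\le n$ be integers, $F=\{0,1,\ldots,q-1\}$, $\overline F=F\setminus\{0\}$, $N=\{1,\ldots,n\}$. For $x\in F^n$, $\overline x=\{i\mid x_i\ne0\}$; $X=W_w(n,q)$ is the set of $x\in F^n$ with $|\overline x|=w$. For $Y\subset X$, subsets $\mathcal{S}=\{i_1<\cdots<i_s\}\subset\mathcal{R}\subset N$ and $\omega\in\overline F^s$, put $m_{\mathcal R,\mathcal S}(Y,\omega)=|\{y\in Y\mid\mathcal R\subset\overline y,\ y_{i_j}=\omega_j\ (j=1,\ldots,s)\}|$. For integers $0\le s\le r\le w$, a subset $Y\subset X$ is an $(r,s)$-$(n,w,q,\lambda)$-design if $m_{\mathcal R,\mathcal S}(Y,\omega)=\lambda$ for all $\omega\in\overline F^s$ and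 all $\mathcal S\subset\mathcal R\subset N$ with $|\mathcal S|=s$, $|\mathcal R|=r$. (The index set of coordinates of vectors in $Y'$ is $N\setminus\mathcal R'$, of size $n-r'$.) -}

module Defs where

open import Data.Nat using (ℕ; zero; suc; _+_)
open import Data.Bool using (Bool; true; false)
open import Data.Fin using (Fin)
import Data.Fin as Fin
import Data.Fin.Properties as FinP
open import Data.Fin.Subset using (Subset; _⊆_; ∣_∣)
open import Data.Fin.Subset.Properties using (_⊆?_)
open import Data.Vec using (Vec; []; _∷_; toList)
open import Data.List using (List; []; _∷_; filter; length; map)
open import Data.List.Properties using (≡-dec)
open import Data.Product using (_×_)
open import Data.List.Relation.Unary.All using (All)
open import Relation.Binary.PropositionalEquality using (_≡_)
open import Relation.Nullary.Decidable using (Dec; _×-dec_)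

nz : ∀ {q} → Fin q → Bool
nz Fin.zero    = false
nz (Fin.suc _) = true

support : ∀ {q n} → Vec (Fin q) n → Subset n
support []       = []
support (a ∷ y)  = nz a ∷ support y

weight : ∀ {q n} → Vec (Fin q) n → ℕ
weight y = ∣ support y ∣

-- entries of y at the positions of S, listed in increasing order of position:
-- select S y = (y_{i_1}, …, y_{i_s})  for S = {i_1 < ⋯ < i_s}
select : ∀ {A : Set} {n} → Subset n → Vec A n → List A
select []          []      = []
select (true ∷ S)  (a ∷ y) = a ∷ select S y
select (false ∷ S) (a ∷ y) = select S y

nOut : ∀ {n} → Subset n → ℕ
nOut []          = 0
nOut (true ∷ R)  = nOut R
nOut (false ∷ R) = suc (nOut R)

restrict : ∀ {A : Set} {n} (R : Subset n) → Vec A n → Vec A (nOut R)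
restrict []          []      = []
restrict (true ∷ R)  (a ∷ y) = restrict R y
restrict (false ∷ R) (a ∷ y) = a ∷ restrict R y

cond? : ∀ {q n s} (R S : Subset n) (ω : Vec (Fin q) s) (y : Vec (Fin q) n) →
        Dec ((R ⊆ support y) × (select S y ≡ toList ω))
cond? R S ω y = (R ⊆? support y) ×-dec ≡-dec FinP._≟_ (select S y) (toList ω)

selectWords : ∀ {q n s} (R S : Subset n) (ω : Vec (Fin q) s) →
              List (Vec (Fin q) n) → List (Vec (Fin q) n)
selectWords R S ω Y = filter (cond? R S ω) Y

mult : ∀ {q n s} (R S : Subset n) (ω : Vec (Fin q) s) → List (Vec (Fin q) n) → ℕ
mult R S ω Y = length (selectWords R S ω Y)

NonzeroVec : ∀ {q s} → Vec (Fin q) s → Set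
NonzeroVec ω = All (λ a → nz a ≡ true) (toList ω)

-- the derived family Y' (a list, i.e. multiset: one entry per y ∈ Y satisfying the condition)
derived : ∀ {q n s} (R S : Subset n) (ω : Vec (Fin q) s) →
          List (Vec (Fin q) n) → List (Vec (Fin q) (nOut R))
derived R S ω Y = map (restrict R) (selectWords R S ω Y)

-- Y ⊂ W_w(n,q) is an (r,s)-(n,w,q,λ)-design (Y given as a list; counts with multiplicity)
IsDesign : (n w q r s lam : ℕ) → List (Vec (Fin q) n) → Set
IsDesign n w q r s lam Y =
  All (λ y → weight y ≡ w) Y ×
  ((R S : Subset n) → S ⊆ R → ∣ S ∣ ≡ s → ∣ R ∣ ≡ r →
   (ω : Vec (Fin q) s) → NonzeroVec ω → mult R S ω Y ≡ lam)

module Submission where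

-- Fix R' ⊇ S' and ω. A pair S'' ⊆ R'' of coordinate sets of N ∖ R' lifts to S = S' ∪ S''
-- ⊆ R = R' ∪ R'' in N, with |R| = r and |S| = s, and ω together with ω'' interleave (in
-- the order of the coordinates of S) to a word ω̃ ∈ F̄^s. A word y ∈ Y satisfies the
-- condition for (R, S, ω̃) exactly when it satisfies the one for (R', S', ω) and its
-- restriction to N ∖ R' satisfies the one for (R'', S'', ω''). Hence
-- m_{R'',S''}(Y', ω'') = m_{R,S}(Y, ω̃) = λ. Weights drop by |R'| because R' ⊆ ȳ.

open import Defs
open import Data.Nat using (ℕ; _≤_; _∸_)
open import Data.Fin using (Fin)
open import Data.Fin.Subset using (Subset; _⊆_; ∣_∣)
open import Data.Vec using (Vec)
open import Data.List using (List)
open import Data.List.Relation.Unary.Unique.Propositional using (Unique)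
open import Data.Product using (_×_)
open import Relation.Binary.PropositionalEquality using (_≡_)

open import Level using (Level; 0ℓ)
open import Data.Nat using (suc; _+_)
open import Data.Nat.Properties using (+-suc; m+n∸n≡m; m+[n∸m]≡n; suc-injective)
open import Data.Bool using (true; false)
open import Data.Fin.Subset using (_⊈_)
open import Data.Fin.Subset.Properties using (drop-∷-⊆; out⊆; ⊆-refl)
open import Data.Vec using ([]; _∷_; here; there; toList; fromList; cast)
open import Data.Vec.Properties using (length-toList; toList-cast; toList∘fromList)
import Data.List as List
open import Data.List using (filter; length; map; _++_)
open import Data.List.Properties using (∷-injective; length-map; filter-≐)
open import Data.List.Relation.Unary.All as All using (All)
open import Data.List.Relation.Unary.All.Properties using (++⁺; map⁺; all-filter; filter⁺)
open import Data.Product using (_,_)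
open import Data.Empty using (⊥-elim)
open import Relation.Binary.PropositionalEquality
  using (refl; sym; trans; cong; cong₂; subst; module ≡-Reasoning)
open import Relation.Nullary.Decidable using (does; _×-dec_)
open import Relation.Unary using (Pred; Decidable; _≐_)

private
  variable
    A B : Set
    n q : ℕ
    ℓ : Level

m+n≡o⇒m≡o∸n : ∀ {m n o} → m + n ≡ o → m ≡ o ∸ n
m+n≡o⇒m≡o∸n {m} {n} refl = sym (m+n∸n≡m m n)

filter-map : ∀ {P : Pred B ℓ} (P? : Decidable P) (f : A → B) xs →
             filter P? (map f xs) ≡ map f (filter (λ x → P? (f x)) xs)
filter-map P? f List.[] = refl
filter-map P? f (x List.∷ xs) with does (P? (f x))
... | true  = cong (f x List.∷_) (filter-map P? f xs)
... | false = filter-map P? f xs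

filter-filter : ∀ {P Q : Pred A ℓ} (P? : Decidable P) (Q? : Decidable Q) xs →
                filter Q? (filter P? xs) ≡ filter (λ x → P? x ×-dec Q? x) xs
filter-filter P? Q? List.[] = refl
filter-filter P? Q? (x List.∷ xs) with does (P? x)
... | false = filter-filter P? Q? xs
... | true with does (Q? x)
...   | true  = cong (x List.∷_) (filter-filter P? Q? xs)
...   | false = filter-filter P? Q? xs

in⊈out : {p r : Subset n} → true ∷ p ⊈ false ∷ r
in⊈out h with () ← h here

∷-⊆-∷ : ∀ {m x y} {p r : Subset m} {p′ r′ : Subset n} → x ∷ p ⊆ y ∷ r → p′ ⊆ r′ → x ∷ p′ ⊆ y ∷ r′
∷-⊆-∷ h h′ here with here ← h here = here
∷-⊆-∷ h h′ (there i) = there (h′ i)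

∣restrict∣+∣R∣≡∣U∣ : ∀ (R U : Subset n) → R ⊆ U → ∣ restrict R U ∣ + ∣ R ∣ ≡ ∣ U ∣
∣restrict∣+∣R∣≡∣U∣ []          []          _ = refl
∣restrict∣+∣R∣≡∣U∣ (true ∷ R)  (true ∷ U)  h =
  trans (+-suc _ ∣ R ∣) (cong suc (∣restrict∣+∣R∣≡∣U∣ R U (drop-∷-⊆ h)))
∣restrict∣+∣R∣≡∣U∣ (true ∷ R)  (false ∷ U) h = ⊥-elim (in⊈out h)
∣restrict∣+∣R∣≡∣U∣ (false ∷ R) (true ∷ U)  h = cong suc (∣restrict∣+∣R∣≡∣U∣ R U (drop-∷-⊆ h))
∣restrict∣+∣R∣≡∣U∣ (false ∷ R) (false ∷ U) h = ∣restrict∣+∣R∣≡∣U∣ R U (drop-∷-⊆ h)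

nOut+∣R∣≡n : (R : Subset n) → nOut R + ∣ R ∣ ≡ n
nOut+∣R∣≡n []          = refl
nOut+∣R∣≡n (true ∷ R)  = trans (+-suc (nOut R) ∣ R ∣) (cong suc (nOut+∣R∣≡n R))
nOut+∣R∣≡n (false ∷ R) = cong suc (nOut+∣R∣≡n R)

support-restrict : (R : Subset n) (y : Vec (Fin q) n) →
                   support (restrict R y) ≡ restrict R (support y)
support-restrict []          []      = refl
support-restrict (true ∷ R)  (a ∷ y) = support-restrict R y
support-restrict (false ∷ R) (a ∷ y) = cong (nz a ∷_) (support-restrict R y)

weight-restrict : (R : Subset n) (y : Vec (Fin q) n) → R ⊆ support y →
                  weight (restrict R y) + ∣ R ∣ ≡ weight y
weight-restrict R y R⊆ȳ = trans (cong (λ U → ∣ U ∣ + ∣ R ∣) (support-restrict R y))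
                                (∣restrict∣+∣R∣≡∣U∣ R (support y) R⊆ȳ)

-- splice R X T agrees with X on R and with T (reindexed) on N ∖ R;
-- for X ⊆ R it is X ∪ T with T lifted from N ∖ R to N.
splice : (R : Subset n) → Subset n → Subset (nOut R) → Subset n
splice []          []      []      = []
splice (true ∷ R)  (x ∷ X) T       = x ∷ splice R X T
splice (false ∷ R) (x ∷ X) (t ∷ T) = t ∷ splice R X T

∣splice∣ : ∀ (R X : Subset n) T → X ⊆ R → ∣ splice R X T ∣ ≡ ∣ X ∣ + ∣ T ∣
∣splice∣ []          []          []         _ = refl
∣splice∣ (true ∷ R)  (true ∷ X)  T          h = cong suc (∣splice∣ R X T (drop-∷-⊆ h))
∣splice∣ (true ∷ R)  (false ∷ X) T          h = ∣splice∣ R X T (drop-∷-⊆ h)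
∣splice∣ (false ∷ R) (true ∷ X)  T          h = ⊥-elim (in⊈out h)
∣splice∣ (false ∷ R) (false ∷ X) (true ∷ T) h =
  trans (cong suc (∣splice∣ R X T (drop-∷-⊆ h))) (sym (+-suc ∣ X ∣ ∣ T ∣))
∣splice∣ (false ∷ R) (false ∷ X) (false ∷ T) h = ∣splice∣ R X T (drop-∷-⊆ h)

splice-mono : ∀ (R X X′ : Subset n) T T′ → X ⊆ X′ → T ⊆ T′ → splice R X T ⊆ splice R X′ T′
splice-mono []          []      []        []       []        _ _ ()
splice-mono (true ∷ R)  (x ∷ X) (x′ ∷ X′) T        T′        h k =
  ∷-⊆-∷ h (splice-mono R X X′ T T′ (drop-∷-⊆ h) k)
splice-mono (false ∷ R) (x ∷ X) (x′ ∷ X′) (t ∷ T) (t′ ∷ T′) h k =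
  ∷-⊆-∷ k (splice-mono R X X′ T T′ (drop-∷-⊆ h) (drop-∷-⊆ k))

splice-⊆⁻ : ∀ (R : Subset n) T U → splice R R T ⊆ U → R ⊆ U × T ⊆ restrict R U
splice-⊆⁻ []          []      []      h = h , h
splice-⊆⁻ (true ∷ R)  T       (u ∷ U) h =
  let R⊆U , T⊆U∖R = splice-⊆⁻ R T U (drop-∷-⊆ h) in ∷-⊆-∷ h R⊆U , T⊆U∖R
splice-⊆⁻ (false ∷ R) (t ∷ T) (u ∷ U) h =
  let R⊆U , T⊆U∖R = splice-⊆⁻ R T U (drop-∷-⊆ h) in out⊆ R⊆U , ∷-⊆-∷ h T⊆U∖R

splice-⊆⁺ : ∀ (R : Subset n) T U → R ⊆ U → T ⊆ restrict R U → splice R R T ⊆ U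
splice-⊆⁺ []          []      []      h k = h
splice-⊆⁺ (true ∷ R)  T       (u ∷ U) h k = ∷-⊆-∷ h (splice-⊆⁺ R T U (drop-∷-⊆ h) k)
splice-⊆⁺ (false ∷ R) (t ∷ T) (u ∷ U) h k =
  ∷-⊆-∷ k (splice-⊆⁺ R T U (drop-∷-⊆ h) (drop-∷-⊆ k))

-- The list read off by select (splice R S T), assembled from the one read off by S and
-- the one read off by T outside R.  It is cut short when a or b runs out; the final
-- a ++ b is what makes select-splice⁻ hold without any length hypotheses.
interleave : (R S : Subset n) → Subset (nOut R) → List A → List A → List A
interleave []          []          []          a            b            = a ++ b
interleave (true ∷ R)  (true ∷ S)  T           List.[]      b            = List.[]
interleave (true ∷ R)  (true ∷ S)  T           (x List.∷ a) b            = x List.∷ interleave R S T a b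
interleave (true ∷ R)  (false ∷ S) T           a            b            = interleave R S T a b
interleave (false ∷ R) (_ ∷ S)     (true ∷ T)  a            List.[]      = List.[]
interleave (false ∷ R) (_ ∷ S)     (true ∷ T)  a            (x List.∷ b) = x List.∷ interleave R S T a b
interleave (false ∷ R) (_ ∷ S)     (false ∷ T) a            b            = interleave R S T a b

select-splice : ∀ (R S : Subset n) T (y : Vec A n) → S ⊆ R →
                select (splice R S T) y ≡ interleave R S T (select S y) (select T (restrict R y))
select-splice []          []          []          []      _ = refl
select-splice (true ∷ R)  (true ∷ S)  T           (a ∷ y) h =
  cong (a List.∷_) (select-splice R S T y (drop-∷-⊆ h))
select-splice (true ∷ R)  (false ∷ S) T           (a ∷ y) h = select-splice R S T y (drop-∷-⊆ h)
select-splice (false ∷ R) (true ∷ S)  T           (a ∷ y) h = ⊥-elim (in⊈out h)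
select-splice (false ∷ R) (false ∷ S) (true ∷ T)  (a ∷ y) h =
  cong (a List.∷_) (select-splice R S T y (drop-∷-⊆ h))
select-splice (false ∷ R) (false ∷ S) (false ∷ T) (a ∷ y) h = select-splice R S T y (drop-∷-⊆ h)

select-splice⁻ : ∀ (R S : Subset n) T (y : Vec A n) → S ⊆ R → ∀ a b →
                 select (splice R S T) y ≡ interleave R S T a b →
                 select S y ≡ a × select T (restrict R y) ≡ b
select-splice⁻ []          []          []          []      _ List.[]      b eq = refl , eq
select-splice⁻ (true ∷ R)  (true ∷ S)  T           (c ∷ y) h (x List.∷ a) b eq =
  let c≡x , eq′ = ∷-injective eq
      a≡ , b≡ = select-splice⁻ R S T y (drop-∷-⊆ h) a b eq′
  in cong₂ List._∷_ c≡x a≡ , b≡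
select-splice⁻ (true ∷ R)  (false ∷ S) T           (c ∷ y) h a b eq =
  select-splice⁻ R S T y (drop-∷-⊆ h) a b eq
select-splice⁻ (false ∷ R) (true ∷ S)  T           (c ∷ y) h a b eq = ⊥-elim (in⊈out h)
select-splice⁻ (false ∷ R) (false ∷ S) (true ∷ T)  (c ∷ y) h a (x List.∷ b) eq =
  let c≡x , eq′ = ∷-injective eq
      a≡ , b≡ = select-splice⁻ R S T y (drop-∷-⊆ h) a b eq′
  in a≡ , cong₂ List._∷_ c≡x b≡
select-splice⁻ (false ∷ R) (false ∷ S) (false ∷ T) (c ∷ y) h a b eq =
  select-splice⁻ R S T y (drop-∷-⊆ h) a b eq

length-interleave : ∀ (R S : Subset n) T (a b : List A) → S ⊆ R →
                    length a ≡ ∣ S ∣ → length b ≡ ∣ T ∣ → length (interleave R S T a b) ≡ ∣ splice R S T ∣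
length-interleave []          []          []          List.[]      List.[]      _ _  _  = refl
length-interleave (true ∷ R)  (true ∷ S)  T           (x List.∷ a) b            h la lb =
  cong suc (length-interleave R S T a b (drop-∷-⊆ h) (suc-injective la) lb)
length-interleave (true ∷ R)  (false ∷ S) T           a            b            h la lb =
  length-interleave R S T a b (drop-∷-⊆ h) la lb
length-interleave (false ∷ R) (true ∷ S)  T           a            b            h la lb = ⊥-elim (in⊈out h)
length-interleave (false ∷ R) (false ∷ S) (true ∷ T)  a            (x List.∷ b) h la lb =
  cong suc (length-interleave R S T a b (drop-∷-⊆ h) la (suc-injective lb))
length-interleave (false ∷ R) (false ∷ S) (false ∷ T) a            b            h la lb =
  length-interleave R S T a b (drop-∷-⊆ h) la lb

interleave⁺ : ∀ {P : Pred A ℓ} (R S : Subset n) T {a b} → All P a → All P b → All P (interleave R S T a b)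
interleave⁺ []          []          []          pa            pb            = ++⁺ pa pb
interleave⁺ (true ∷ R)  (true ∷ S)  T           All.[]        pb            = All.[]
interleave⁺ (true ∷ R)  (true ∷ S)  T           (px All.∷ pa) pb            = px All.∷ interleave⁺ R S T pa pb
interleave⁺ (true ∷ R)  (false ∷ S) T           pa            pb            = interleave⁺ R S T pa pb
interleave⁺ (false ∷ R) (_ ∷ S)     (true ∷ T)  pa            All.[]        = All.[]
interleave⁺ (false ∷ R) (_ ∷ S)     (true ∷ T)  pa            (px All.∷ pb) = px All.∷ interleave⁺ R S T pa pb
interleave⁺ (false ∷ R) (_ ∷ S)     (false ∷ T) pa            pb            = interleave⁺ R S T pa pb

Matches : (R S : Subset n) → List (Fin q) → Pred (Vec (Fin q) n) 0ℓ
Matches R S a y = R ⊆ support y × select S y ≡ a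

matches-splice : ∀ (R S : Subset n) T U (a b : List (Fin q)) → S ⊆ R →
                 Matches (splice R R T) (splice R S U) (interleave R S U a b)
                   ≐ (λ y → Matches R S a y × Matches T U b (restrict R y))
matches-splice R S T U a b S⊆R = split , join
  where
  split : ∀ {y} → Matches (splice R R T) (splice R S U) (interleave R S U a b) y →
          Matches R S a y × Matches T U b (restrict R y)
  split {y} (R∪T⊆ȳ , sel≡) =
    let R⊆ȳ , T⊆ȳ∖R = splice-⊆⁻ R T (support y) R∪T⊆ȳ
        selS≡a , selT≡b = select-splice⁻ R S U y S⊆R a b sel≡
    in (R⊆ȳ , selS≡a) , (subst (T ⊆_) (sym (support-restrict R y)) T⊆ȳ∖R , selT≡b)
  join : ∀ {y} → Matches R S a y × Matches T U b (restrict R y) →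
         Matches (splice R R T) (splice R S U) (interleave R S U a b) y
  join {y} ((R⊆ȳ , selS≡a) , (T⊆ȳ∖R , selT≡b)) =
    splice-⊆⁺ R T (support y) R⊆ȳ (subst (T ⊆_) (support-restrict R y) T⊆ȳ∖R) ,
    trans (select-splice R S U y S⊆R) (cong₂ (interleave R S U) selS≡a selT≡b)

mult-derived : ∀ {s t k} (R S : Subset n) T U (ω : Vec (Fin q) s) (ω″ : Vec (Fin q) t)
               (ω̃ : Vec (Fin q) k) Y → S ⊆ R → toList ω̃ ≡ interleave R S U (toList ω) (toList ω″) →
               mult T U ω″ (derived R S ω Y) ≡ mult (splice R R T) (splice R S U) ω̃ Y
mult-derived {n = n} {q = q} R S T U ω ω″ ω̃ Y S⊆R ω̃≡ = begin
  length (filter (cond? T U ω″) (map (restrict R) selected))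
    ≡⟨ cong length (filter-map (cond? T U ω″) (restrict R) selected) ⟩
  length (map (restrict R) (filter inner? selected))
    ≡⟨ length-map (restrict R) (filter inner? selected) ⟩
  length (filter inner? selected)
    ≡⟨ cong length (filter-filter (cond? R S ω) inner? Y) ⟩
  length (filter (λ y → cond? R S ω y ×-dec inner? y) Y)
    ≡⟨ cong length (filter-≐ _ (cond? R̃ S̃ ω̃) matches Y) ⟩
  length (filter (cond? R̃ S̃ ω̃) Y)
    ∎
  where
  open ≡-Reasoning
  R̃ S̃ : Subset n
  R̃ = splice R R T
  S̃ = splice R S U
  selected : List (Vec (Fin q) n)
  selected = filter (cond? R S ω) Y
  inner? : Decidable (λ y → Matches T U (toList ω″) (restrict R y))
  inner? y = cond? T U ω″ (restrict R y)
  matches : (λ y → Matches R S (toList ω) y × Matches T U (toList ω″) (restrict R y))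
              ≐ Matches R̃ S̃ (toList ω̃)
  matches = let split , join = matches-splice R S T U (toList ω) (toList ω″) S⊆R
            in subst (λ l → _ ≐ Matches R̃ S̃ l) (sym ω̃≡) (join , split)

derived-weight : ∀ {s w} (R S : Subset n) (ω : Vec (Fin q) s) Y → All (λ y → weight y ≡ w) Y →
                 All (λ y → weight y ≡ w ∸ ∣ R ∣) (derived R S ω Y)
derived-weight {w = w} R S ω Y weights =
  map⁺ (All.zipWith restricted (filter⁺ (cond? R S ω) weights , all-filter (cond? R S ω) Y))
  where
  restricted : ∀ {y} → weight y ≡ w × Matches R S (toList ω) y → weight (restrict R y) ≡ w ∸ ∣ R ∣
  restricted {y} (wy≡w , R⊆ȳ , _) = m+n≡o⇒m≡o∸n (trans (weight-restrict R y R⊆ȳ) wy≡w)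

IsBalanced : (n q r s lam : ℕ) → List (Vec (Fin q) n) → Set
IsBalanced n q r s lam Y =
  (R S : Subset n) → S ⊆ R → ∣ S ∣ ≡ s → ∣ R ∣ ≡ r →
  (ω : Vec (Fin q) s) → NonzeroVec ω → mult R S ω Y ≡ lam

derived-balanced : ∀ {r s lam} (Y : List (Vec (Fin q) n)) → IsBalanced n q r s lam Y →
                   (R S : Subset n) → S ⊆ R → ∣ S ∣ ≤ s → ∣ R ∣ ≤ r →
                   (ω : Vec (Fin q) ∣ S ∣) → NonzeroVec ω →
                   IsBalanced (nOut R) q (r ∸ ∣ R ∣) (s ∸ ∣ S ∣) lam (derived R S ω Y)
derived-balanced {q = q} {r = r} {s} Y balanced R S S⊆R ∣S∣≤s ∣R∣≤r ω nzω T U U⊆T ∣U∣≡ ∣T∣≡ ω″ nzω″ =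
  trans (mult-derived R S T U ω ω″ ω̃ Y S⊆R ω̃≡)
        (balanced (splice R R T) (splice R S U) (splice-mono R S R U T S⊆R U⊆T) ∣S∪U∣≡s ∣R∪T∣≡r ω̃ nzω̃)
  where
  ∣S∪U∣≡s : ∣ splice R S U ∣ ≡ s
  ∣S∪U∣≡s = trans (∣splice∣ R S U S⊆R) (trans (cong (∣ S ∣ +_) ∣U∣≡) (m+[n∸m]≡n ∣S∣≤s))
  ∣R∪T∣≡r : ∣ splice R R T ∣ ≡ r
  ∣R∪T∣≡r = trans (∣splice∣ R R T ⊆-refl) (trans (cong (∣ R ∣ +_) ∣T∣≡) (m+[n∸m]≡n ∣R∣≤r))
  word : List (Fin q)
  word = interleave R S U (toList ω) (toList ω″)
  ω̃ : Vec (Fin q) s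
  ω̃ = cast (trans (length-interleave R S U _ _ S⊆R (length-toList ω) (trans (length-toList ω″) (sym ∣U∣≡)))
                  ∣S∪U∣≡s)
           (fromList word)
  ω̃≡ : toList ω̃ ≡ word
  ω̃≡ = trans (toList-cast _ (fromList word)) (toList∘fromList word)
  nzω̃ : NonzeroVec ω̃
  nzω̃ = subst (All (λ a → nz a ≡ true)) (sym ω̃≡) (interleave⁺ R S U nzω nzω″)

proposition4p2 : (q n w r s lam : ℕ) → 2 ≤ q → 1 ≤ n → w ≤ n → s ≤ r → r ≤ w →
    (Y : List (Vec (Fin q) n)) → Unique Y → IsDesign n w q r s lam Y →
    (s' r' : ℕ) → s' ≤ s → s' ≤ r' → r' ≤ r →
    (ω : Vec (Fin q) s') → NonzeroVec ω →
    (S' R' : Subset n) → S' ⊆ R' → ∣ S' ∣ ≡ s' → ∣ R' ∣ ≡ r' →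
    nOut R' ≡ n ∸ r' ×
    IsDesign (nOut R') (w ∸ r') q (r ∸ r') (s ∸ s') lam (derived R' S' ω Y)
proposition4p2 q n w r s lam _ _ _ _ _ Y _ (weights , balanced) _ _ s'≤s _ r'≤r ω nzω S' R' S'⊆R' refl refl =
  m+n≡o⇒m≡o∸n (nOut+∣R∣≡n R') ,
  derived-weight R' S' ω Y weights ,
  derived-balanced Y balanced R' S' S'⊆R' s'≤s r'≤r ω nzω
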